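{- Let $\{\divideontimes_i\mid i\in I\}$ be a signature of operation and relation symbols, each with a fixed interpretation on partial functions, and let $\divideontimes$ be an $n$-ary operation on partial functions that is abstractly definable from $\{\divideontimes_i\mid i\in I\}$ by a first-order formula $\phi(x,x_1,\dots,x_n)$. If $\Sigma$ is a sound and complete axiomatisation for $\operatorname{Rep}(\{\divideontimes_i\mid i\in I\})$, then $\Sigma\cup\{\forall x_1\dots\forall x_n\,\phi(\divideontimes(x_1,\dots,x_n),x_1,\dots,x_n)\}$ is a sound and complete axiomatisation for $\operatorname{Rep}(\{\divideontimes_i\mid i\in I\}\cup\{\divideontimes\})$.
   Context: Partial functions: elements of $\mathcal{P}(X,Y)$, the set of partial maps from a nonempty set $X$ to a nonempty set $Y$. For a signature $\sigma$ of operations/relations with fixed interpretations on partial functions, a $\sigma$-algebra of functions is a subset of some $\mathcal{P}(X,Y)$ closed under the operations of $\sigma$ (with relations interpreted concretely), and $\operatorname{Rep}(\sigma)$ is the class of $\sigma$-structures isomorphic to $\sigma$-algebras of functions. An axiomatisation $\Sigma$ is sound and complete for $\operatorname{Rep}(\sigma)$ if the models of $\Sigma$ are exactly the members of $\operatorname{Rep}(\sigma)$. An $n$-ary operation $\divideontimes$ on partial functions is abstractly definable from $\sigma$ by a first-order $\sigma$-formula $\phi(x,x_1,\dots,x_n)$ if in every $\sigma$-algebra of functions (not necessarily closed under $\divideontimes$), for all elements $h,f_1,\dots,f_n$, one has $h=\divideontimes(f_1,\dots,f_n)$ iff $\phi(h,f_1,\dots,f_n)$ holds. -}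

module Defs where

open import Data.Nat using (ℕ; zero; suc)
open import Data.Fin using (Fin; zero; suc)
open import Data.Maybe using (Maybe)
open import Data.Product using (Σ; _×_; _,_; proj₁; proj₂)
open import Data.Sum using (_⊎_; inj₁; inj₂)
open import Data.Empty using (⊥)
open import Data.Unit using (⊤; tt)
open import Relation.Nullary using (¬_)
open import Relation.Binary using (IsEquivalence)
open import Relation.Binary.PropositionalEquality using (_≡_)

PF : Set → Set → Set
PF X Y = X → Maybe Y

_≈ₚ_ : {X Y : Set} → PF X Y → PF X Y → Set
f ≈ₚ g = ∀ x → f x ≡ g x

infix 4 _≈ₚ_

record Signature : Set₁ where
  field
    Op    : Set
    opAr  : Op → ℕ
    Rel   : Set
    relAr : Rel → ℕ
open Signature public

-- A fixed interpretation of a signature on partial functions.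
-- 'Base' indexes the admissible function sets P(Dom k, Cod k)
-- (e.g. Base = Set × Set for general P(X,Y), or Base = Set with
-- Dom = Cod = id when composition is in the signature).
record PFInterp (σ : Signature) : Set₂ where
  field
    Base     : Set₁
    Dom Cod  : Base → Set
    ⟦op⟧     : (o : Op σ) (k : Base) → (Fin (opAr σ o) → PF (Dom k) (Cod k)) → PF (Dom k) (Cod k)
    ⟦rel⟧    : (r : Rel σ) (k : Base) → (Fin (relAr σ r) → PF (Dom k) (Cod k)) → Set
    ⟦op⟧-cong  : ∀ o k {fs gs} → (∀ j → fs j ≈ₚ gs j) → ⟦op⟧ o k fs ≈ₚ ⟦op⟧ o k gs
    ⟦rel⟧-cong : ∀ r k {fs gs} → (∀ j → fs j ≈ₚ gs j) → ⟦rel⟧ r k fs → ⟦rel⟧ r k gs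
open PFInterp public

record PFOp {σ : Signature} (I : PFInterp σ) (n : ℕ) : Set₁ where
  field
    run  : (k : Base I) → (Fin n → PF (Dom I k) (Cod I k)) → PF (Dom I k) (Cod I k)
    cong : ∀ k {fs gs} → (∀ j → fs j ≈ₚ gs j) → run k fs ≈ₚ run k gs
open PFOp public

record Structure (σ : Signature) : Set₁ where
  field
    Carrier : Set
    _≈_     : Carrier → Carrier → Set
    isEquiv : IsEquivalence _≈_
    op      : (o : Op σ) → (Fin (opAr σ o) → Carrier) → Carrier
    rel     : (r : Rel σ) → (Fin (relAr σ r) → Carrier) → Set
    op-cong  : ∀ o {as bs} → (∀ j → as j ≈ bs j) → op o as ≈ op o bs
    rel-cong : ∀ r {as bs} → (∀ j → as j ≈ bs j) → rel r as → rel r bs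
open Structure public

record _≅_ {σ : Signature} (S T : Structure σ) : Set where
  field
    to      : Carrier S → Carrier T
    from    : Carrier T → Carrier S
    to-cong   : ∀ {a b} → _≈_ S a b → _≈_ T (to a) (to b)
    from-cong : ∀ {a b} → _≈_ T a b → _≈_ S (from a) (from b)
    to-from : ∀ b → _≈_ T (to (from b)) b
    from-to : ∀ a → _≈_ S (from (to a)) a
    to-op   : ∀ o as → _≈_ T (to (op S o as)) (op T o (λ j → to (as j)))
    to-rel   : ∀ r as → rel S r as → rel T r (λ j → to (as j))
    to-rel⁻¹ : ∀ r as → rel T r (λ j → to (as j)) → rel S r as

Closed : {σ : Signature} (I : PFInterp σ) (k : Base I) → (PF (Dom I k) (Cod I k) → Set) → Set
Closed {σ} I k A = ∀ o (fs : Fin (opAr σ o) → PF (Dom I k) (Cod I k)) → (∀ j → A (fs j)) → A (⟦op⟧ I o k fs)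

algebra : {σ : Signature} (I : PFInterp σ) (k : Base I) (A : PF (Dom I k) (Cod I k) → Set) → Closed I k A → Structure σ
algebra {σ} I k A cl = record
  { Carrier = Σ (PF (Dom I k) (Cod I k)) A
  ; _≈_ = λ f g → proj₁ f ≈ₚ proj₁ g
  ; isEquiv = record
      { refl = λ x → Relation.Binary.PropositionalEquality.refl
      ; sym = λ p x → Relation.Binary.PropositionalEquality.sym (p x)
      ; trans = λ p q x → Relation.Binary.PropositionalEquality.trans (p x) (q x) }
  ; op = λ o as → ⟦op⟧ I o k (λ j → proj₁ (as j)) , cl o (λ j → proj₁ (as j)) (λ j → proj₂ (as j))
  ; rel = λ r as → ⟦rel⟧ I r k (λ j → proj₁ (as j))
  ; op-cong = λ o p → ⟦op⟧-cong I o k p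
  ; rel-cong = λ r p → ⟦rel⟧-cong I r k p
  }

-- Rep(σ): structures isomorphic to a σ-algebra of functions on
-- some P(X,Y) with X, Y nonempty
Rep : {σ : Signature} (I : PFInterp σ) → Structure σ → Set₁
Rep I S = Σ (Base I) λ k → Dom I k × Cod I k ×
          Σ (PF (Dom I k) (Cod I k) → Set) λ A → Σ (Closed I k A) λ cl → S ≅ algebra I k A cl

data Term (σ : Signature) (n : ℕ) : Set where
  var : Fin n → Term σ n
  app : (o : Op σ) → (Fin (opAr σ o) → Term σ n) → Term σ n

data Formula (σ : Signature) : ℕ → Set where
  _≐_  : ∀ {n} → Term σ n → Term σ n → Formula σ n
  rel' : ∀ {n} (r : Rel σ) → (Fin (relAr σ r) → Term σ n) → Formula σ n
  ⊥'   : ∀ {n} → Formula σ n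
  ¬'_  : ∀ {n} → Formula σ n → Formula σ n
  _∧'_ _∨'_ _⇒'_ : ∀ {n} → Formula σ n → Formula σ n → Formula σ n
  ∀' ∃' : ∀ {n} → Formula σ (suc n) → Formula σ n

_∷ᵉ_ : {A : Set} {n : ℕ} → A → (Fin n → A) → Fin (suc n) → A
(a ∷ᵉ ρ) zero = a
(a ∷ᵉ ρ) (suc i) = ρ i

⟦_⟧ₜ : {σ : Signature} {n : ℕ} → Term σ n → (S : Structure σ) → (Fin n → Carrier S) → Carrier S
⟦ var i ⟧ₜ S ρ = ρ i
⟦ app o ts ⟧ₜ S ρ = op S o (λ j → ⟦ ts j ⟧ₜ S ρ)

_⊨_[_] : {σ : Signature} {n : ℕ} (S : Structure σ) → Formula σ n → (Fin n → Carrier S) → Set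
S ⊨ (t ≐ u) [ ρ ] = _≈_ S (⟦ t ⟧ₜ S ρ) (⟦ u ⟧ₜ S ρ)
S ⊨ rel' r ts [ ρ ] = rel S r (λ j → ⟦ ts j ⟧ₜ S ρ)
S ⊨ ⊥' [ ρ ] = ⊥
S ⊨ (¬' φ) [ ρ ] = ¬ (S ⊨ φ [ ρ ])
S ⊨ (φ ∧' ψ) [ ρ ] = (S ⊨ φ [ ρ ]) × (S ⊨ ψ [ ρ ])
S ⊨ (φ ∨' ψ) [ ρ ] = (S ⊨ φ [ ρ ]) ⊎ (S ⊨ ψ [ ρ ])
S ⊨ (φ ⇒' ψ) [ ρ ] = (S ⊨ φ [ ρ ]) → (S ⊨ ψ [ ρ ])
S ⊨ ∀' φ [ ρ ] = (a : Carrier S) → S ⊨ φ [ a ∷ᵉ ρ ]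
S ⊨ ∃' φ [ ρ ] = Σ (Carrier S) λ a → S ⊨ φ [ a ∷ᵉ ρ ]

Theory : Signature → Set₁
Theory σ = Formula σ zero → Set

noEnv : {A : Set} → Fin zero → A
noEnv ()

Models : {σ : Signature} → Theory σ → Structure σ → Set
Models T S = ∀ ψ → T ψ → S ⊨ ψ [ noEnv ]

SoundComplete : {σ : Signature} (I : PFInterp σ) → Theory σ → Set₁
SoundComplete {σ} I T = (S : Structure σ) → (Models T S → Rep I S) × (Rep I S → Models T S)

-- Abstract definability of an n-ary operation by φ(x, x₁,…,xₙ)
-- (variable zero is x, variable suc j is x_{j+1})

AbstractlyDefinable : {σ : Signature} (I : PFInterp σ) (n : ℕ) → PFOp I n → Formula σ (suc n) → Set₁
AbstractlyDefinable {σ} I n ⊛ φ =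
  (k : Base I) → Dom I k → Cod I k →
  (A : PF (Dom I k) (Cod I k) → Set) (cl : Closed I k A) →
  (h : Carrier (algebra I k A cl)) (fs : Fin n → Carrier (algebra I k A cl)) →
  (proj₁ h ≈ₚ run ⊛ k (λ j → proj₁ (fs j)) → algebra I k A cl ⊨ φ [ h ∷ᵉ fs ])
  × (algebra I k A cl ⊨ φ [ h ∷ᵉ fs ] → proj₁ h ≈ₚ run ⊛ k (λ j → proj₁ (fs j)))

extendSig : Signature → ℕ → Signature
extendSig σ n = record
  { Op = Op σ ⊎ ⊤
  ; opAr = λ { (inj₁ o) → opAr σ o ; (inj₂ _) → n }
  ; Rel = Rel σ
  ; relAr = relAr σ }

extendI : {σ : Signature} (I : PFInterp σ) (n : ℕ) → PFOp I n → PFInterp (extendSig σ n)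
extendI I n ⊛ = record
  { Base = Base I ; Dom = Dom I ; Cod = Cod I
  ; ⟦op⟧ = λ { (inj₁ o) → ⟦op⟧ I o ; (inj₂ _) → run ⊛ }
  ; ⟦rel⟧ = ⟦rel⟧ I
  ; ⟦op⟧-cong = λ { (inj₁ o) → ⟦op⟧-cong I o ; (inj₂ _) → cong ⊛ }
  ; ⟦rel⟧-cong = ⟦rel⟧-cong I }

liftT : {σ : Signature} {n m : ℕ} → Term σ m → Term (extendSig σ n) m
liftT (var i) = var i
liftT (app o ts) = app (inj₁ o) (λ j → liftT (ts j))

liftF : {σ : Signature} {n m : ℕ} → Formula σ m → Formula (extendSig σ n) m
liftF (t ≐ u) = liftT t ≐ liftT u
liftF (rel' r ts) = rel' r (λ j → liftT (ts j))
liftF ⊥' = ⊥'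
liftF (¬' φ) = ¬' liftF φ
liftF (φ ∧' ψ) = liftF φ ∧' liftF ψ
liftF (φ ∨' ψ) = liftF φ ∨' liftF ψ
liftF (φ ⇒' ψ) = liftF φ ⇒' liftF ψ
liftF (∀' φ) = ∀' (liftF φ)
liftF (∃' φ) = ∃' (liftF φ)

renT : {σ : Signature} {n m : ℕ} → (Fin n → Fin m) → Term σ n → Term σ m
renT r (var i) = var (r i)
renT r (app o ts) = app o (λ j → renT r (ts j))

extR : {n m : ℕ} → (Fin n → Fin m) → Fin (suc n) → Fin (suc m)
extR r zero = zero
extR r (suc i) = suc (r i)

substT : {σ : Signature} {n m : ℕ} → (Fin n → Term σ m) → Term σ n → Term σ m
substT s (var i) = s i
substT s (app o ts) = app o (λ j → substT s (ts j))

extS : {σ : Signature} {n m : ℕ} → (Fin n → Term σ m) → Fin (suc n) → Term σ (suc m)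
extS s zero = var zero
extS s (suc i) = renT suc (s i)

substF : {σ : Signature} {n m : ℕ} → (Fin n → Term σ m) → Formula σ n → Formula σ m
substF s (t ≐ u) = substT s t ≐ substT s u
substF s (rel' r ts) = rel' r (λ j → substT s (ts j))
substF s ⊥' = ⊥'
substF s (¬' φ) = ¬' substF s φ
substF s (φ ∧' ψ) = substF s φ ∧' substF s ψ
substF s (φ ∨' ψ) = substF s φ ∨' substF s ψ
substF s (φ ⇒' ψ) = substF s φ ⇒' substF s ψ
substF s (∀' φ) = ∀' (substF (extS s) φ)
substF s (∃' φ) = ∃' (substF (extS s) φ)

∀ⁿ : {σ : Signature} (n : ℕ) → Formula σ n → Formula σ zero
∀ⁿ zero ψ = ψ
∀ⁿ (suc n) ψ = ∀ⁿ n (∀' ψ)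

⊛-subst : {σ : Signature} (n : ℕ) → Fin (suc n) → Term (extendSig σ n) n
⊛-subst n zero = app (inj₂ tt) var
⊛-subst n (suc j) = var j

⊛-axiom : {σ : Signature} (n : ℕ) → Formula σ (suc n) → Formula (extendSig σ n) zero
⊛-axiom n φ = ∀ⁿ n (substF (⊛-subst n) (liftF φ))

extendTheory : {σ : Signature} (n : ℕ) → Theory σ → Formula σ (suc n) → Theory (extendSig σ n)
extendTheory {σ} n T φ ψ = (Σ (Formula σ zero) λ χ → T χ × (ψ ≡ liftF χ)) ⊎ (ψ ≡ ⊛-axiom n φ)

-- Both directions go
-- through the σ-reduct of S:
--   * S satisfies the lifted axioms of T iff its reduct satisfies T, i.e.
--     iff the reduct is isomorphic to a σ-algebra of functions B;
--   * via such an isomorphism, S satisfies the ⊛-axiom iff the isomorphism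
--     carries ⊛ to the concrete operation on B (abstract definability is
--     invariant under isomorphism);
--   * an isomorphism of the reduct that respects ⊛ in this way is a
--     representation of S itself, once B is saturated under pointwise
--     equality of partial functions so that it becomes closed under ⊛.

module Submission where

open import Defs
open import Data.Nat using (ℕ; suc; zero)
open import Data.Fin using (Fin; zero; suc)
open import Data.Product using (Σ; _×_; _,_; proj₁; proj₂)
open import Data.Product.Function.NonDependent.Propositional using (_×-⇔_)
open import Data.Sum using (inj₁; inj₂)
open import Data.Sum.Function.Propositional using (_⊎-⇔_)
open import Data.Unit using (tt)
open import Function using (_∘_)
open import Function.Bundles using (_⇔_; mk⇔; Equivalence)
open import Function.Construct.Identity using (⇔-id)
open import Function.Construct.Symmetry using (⇔-sym)
open import Function.Construct.Composition using (_⇔-∘_)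
open import Function.Related.TypeIsomorphisms using (→-cong-⇔; ¬-cong-⇔)
open import Relation.Binary using (IsEquivalence)
open import Relation.Binary.PropositionalEquality using (refl; sym; trans)

open Equivalence using () renaming (to to forward; from to backward)

module _ {σ : Signature} (S : Structure σ) where
  private module ≈ = IsEquivalence (isEquiv S)

  ≈-refl : ∀ {a} → _≈_ S a a
  ≈-refl = ≈.refl

  ≈-sym : ∀ {a b} → _≈_ S a b → _≈_ S b a
  ≈-sym = ≈.sym

  ≈-trans : ∀ {a b c} → _≈_ S a b → _≈_ S b c → _≈_ S a c
  ≈-trans = ≈.trans

  ≈-resp-⇔ : ∀ {a a′ b b′} → _≈_ S a a′ → _≈_ S b b′ → _≈_ S a b ⇔ _≈_ S a′ b′
  ≈-resp-⇔ a≈a′ b≈b′ =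
    mk⇔ (λ a≈b → ≈-trans (≈-sym a≈a′) (≈-trans a≈b b≈b′))
        (λ a′≈b′ → ≈-trans a≈a′ (≈-trans a′≈b′ (≈-sym b≈b′)))

  rel-resp-⇔ : ∀ r {as bs} → (∀ j → _≈_ S (as j) (bs j)) → rel S r as ⇔ rel S r bs
  rel-resp-⇔ r as≈bs = mk⇔ (rel-cong S r as≈bs) (rel-cong S r (≈-sym ∘ as≈bs))

Π-cong-⇔ : {A : Set} {P Q : A → Set} → (∀ a → P a ⇔ Q a) → (∀ a → P a) ⇔ (∀ a → Q a)
Π-cong-⇔ P⇔Q = mk⇔ (λ p a → forward (P⇔Q a) (p a)) (λ q a → backward (P⇔Q a) (q a))

Σ-cong-⇔ : {A : Set} {P Q : A → Set} → (∀ a → P a ⇔ Q a) → Σ A P ⇔ Σ A Q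
Σ-cong-⇔ P⇔Q =
  mk⇔ (λ (a , p) → a , forward (P⇔Q a) p) (λ (a , q) → a , backward (P⇔Q a) q)

module IsoInvariance {σ : Signature} {S T : Structure σ} (iso : S ≅ T) where
  open _≅_ iso

  _↦_ : {m : ℕ} → (Fin m → Carrier S) → (Fin m → Carrier T) → Set
  ρ ↦ ρ′ = ∀ i → _≈_ T (to (ρ i)) (ρ′ i)

  ∷-↦ : ∀ {m a b} {ρ : Fin m → Carrier S} {ρ′} →
        _≈_ T (to a) b → ρ ↦ ρ′ → (a ∷ᵉ ρ) ↦ (b ∷ᵉ ρ′)
  ∷-↦ a↦b ρ↦ρ′ zero = a↦b
  ∷-↦ a↦b ρ↦ρ′ (suc i) = ρ↦ρ′ i

  to-≈-⇔ : ∀ {a b} → _≈_ S a b ⇔ _≈_ T (to a) (to b)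
  to-≈-⇔ {a} {b} = mk⇔ to-cong λ ta≈tb →
    ≈-trans S (≈-sym S (from-to a)) (≈-trans S (from-cong ta≈tb) (from-to b))

  term-↦ : ∀ {m} (t : Term σ m) {ρ ρ′} → ρ ↦ ρ′ → _≈_ T (to (⟦ t ⟧ₜ S ρ)) (⟦ t ⟧ₜ T ρ′)
  term-↦ (var i) ρ↦ρ′ = ρ↦ρ′ i
  term-↦ (app o ts) ρ↦ρ′ =
    ≈-trans T (to-op o _) (op-cong T o (λ j → term-↦ (ts j) ρ↦ρ′))

  sat-↦ : ∀ {m} (φ : Formula σ m) {ρ ρ′} → ρ ↦ ρ′ → S ⊨ φ [ ρ ] ⇔ T ⊨ φ [ ρ′ ]
  sat-↦ (t ≐ u) ρ↦ρ′ = ≈-resp-⇔ T (term-↦ t ρ↦ρ′) (term-↦ u ρ↦ρ′) ⇔-∘ to-≈-⇔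
  sat-↦ (rel' r ts) ρ↦ρ′ =
    rel-resp-⇔ T r (λ j → term-↦ (ts j) ρ↦ρ′) ⇔-∘ mk⇔ (to-rel r _) (to-rel⁻¹ r _)
  sat-↦ ⊥' ρ↦ρ′ = ⇔-id _
  sat-↦ (¬' φ) ρ↦ρ′ = ¬-cong-⇔ (sat-↦ φ ρ↦ρ′)
  sat-↦ (φ ∧' ψ) ρ↦ρ′ = sat-↦ φ ρ↦ρ′ ×-⇔ sat-↦ ψ ρ↦ρ′
  sat-↦ (φ ∨' ψ) ρ↦ρ′ = sat-↦ φ ρ↦ρ′ ⊎-⇔ sat-↦ ψ ρ↦ρ′
  sat-↦ (φ ⇒' ψ) ρ↦ρ′ = →-cong-⇔ (sat-↦ φ ρ↦ρ′) (sat-↦ ψ ρ↦ρ′)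
  sat-↦ (∀' φ) ρ↦ρ′ =
    mk⇔ (λ H b → forward (sat-↦ φ (∷-↦ (to-from b) ρ↦ρ′)) (H (from b)))
        (λ H a → backward (sat-↦ φ (∷-↦ (≈-refl T) ρ↦ρ′)) (H (to a)))
  sat-↦ (∃' φ) ρ↦ρ′ =
    mk⇔ (λ (a , h) → to a , forward (sat-↦ φ (∷-↦ (≈-refl T) ρ↦ρ′)) h)
        (λ (b , h) → from b , backward (sat-↦ φ (∷-↦ (to-from b) ρ↦ρ′)) h)

open IsoInvariance using (sat-↦)

≅-refl : {σ : Signature} (S : Structure σ) → S ≅ S
≅-refl S = record
  { to = λ a → a ; from = λ a → a ; to-cong = λ p → p ; from-cong = λ p → p
  ; to-from = λ _ → ≈-refl S ; from-to = λ _ → ≈-refl S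
  ; to-op = λ _ _ → ≈-refl S ; to-rel = λ _ _ p → p ; to-rel⁻¹ = λ _ _ p → p }

sat-cong : {σ : Signature} (S : Structure σ) {m : ℕ} (φ : Formula σ m) {ρ ρ′ : Fin m → Carrier S} →
           (∀ i → _≈_ S (ρ i) (ρ′ i)) → S ⊨ φ [ ρ ] → S ⊨ φ [ ρ′ ]
sat-cong S φ ρ≈ρ′ = forward (sat-↦ (≅-refl S) φ ρ≈ρ′)

module Substitution {σ : Signature} (S : Structure σ) where

  Evaluates : ∀ {m m′} → (Fin m → Term σ m′) → (Fin m′ → Carrier S) → (Fin m → Carrier S) → Set
  Evaluates s ρ ρ′ = ∀ i → _≈_ S (⟦ s i ⟧ₜ S ρ) (ρ′ i)

  rename-term : ∀ {m m′} (r : Fin m → Fin m′) (t : Term σ m) (ρ : Fin m′ → Carrier S) →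
                _≈_ S (⟦ renT r t ⟧ₜ S ρ) (⟦ t ⟧ₜ S (ρ ∘ r))
  rename-term r (var i) ρ = ≈-refl S
  rename-term r (app o ts) ρ = op-cong S o (λ j → rename-term r (ts j) ρ)

  subst-term : ∀ {m m′} {s : Fin m → Term σ m′} {ρ ρ′} → Evaluates s ρ ρ′ →
               (t : Term σ m) → _≈_ S (⟦ substT s t ⟧ₜ S ρ) (⟦ t ⟧ₜ S ρ′)
  subst-term s↝ρ′ (var i) = s↝ρ′ i
  subst-term s↝ρ′ (app o ts) = op-cong S o (λ j → subst-term s↝ρ′ (ts j))

  extS-evaluates : ∀ {m m′} {s : Fin m → Term σ m′} {ρ ρ′} → Evaluates s ρ ρ′ →
                   ∀ a → Evaluates (extS s) (a ∷ᵉ ρ) (a ∷ᵉ ρ′)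
  extS-evaluates s↝ρ′ a zero = ≈-refl S
  extS-evaluates {s = s} s↝ρ′ a (suc i) = ≈-trans S (rename-term suc (s i) (a ∷ᵉ _)) (s↝ρ′ i)

  subst-sat : ∀ {m m′} {s : Fin m → Term σ m′} {ρ ρ′} → Evaluates s ρ ρ′ →
              (φ : Formula σ m) → S ⊨ substF s φ [ ρ ] ⇔ S ⊨ φ [ ρ′ ]
  subst-sat s↝ρ′ (t ≐ u) = ≈-resp-⇔ S (subst-term s↝ρ′ t) (subst-term s↝ρ′ u)
  subst-sat s↝ρ′ (rel' r ts) = rel-resp-⇔ S r (λ j → subst-term s↝ρ′ (ts j))
  subst-sat s↝ρ′ ⊥' = ⇔-id _
  subst-sat s↝ρ′ (¬' φ) = ¬-cong-⇔ (subst-sat s↝ρ′ φ)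
  subst-sat s↝ρ′ (φ ∧' ψ) = subst-sat s↝ρ′ φ ×-⇔ subst-sat s↝ρ′ ψ
  subst-sat s↝ρ′ (φ ∨' ψ) = subst-sat s↝ρ′ φ ⊎-⇔ subst-sat s↝ρ′ ψ
  subst-sat s↝ρ′ (φ ⇒' ψ) = →-cong-⇔ (subst-sat s↝ρ′ φ) (subst-sat s↝ρ′ ψ)
  subst-sat s↝ρ′ (∀' φ) = Π-cong-⇔ λ a → subst-sat (extS-evaluates s↝ρ′ a) φ
  subst-sat s↝ρ′ (∃' φ) = Σ-cong-⇔ λ a → subst-sat (extS-evaluates s↝ρ′ a) φ

open Substitution using (subst-sat)

∀ⁿ-sat : {σ : Signature} (S : Structure σ) (m : ℕ) (ψ : Formula σ m) →
         S ⊨ ∀ⁿ m ψ [ noEnv ] ⇔ (∀ ρ → S ⊨ ψ [ ρ ])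
∀ⁿ-sat S zero ψ = mk⇔ (λ H ρ → sat-cong S ψ (λ ()) H) (λ H → H noEnv)
∀ⁿ-sat S (suc m) ψ = uncurry-env ⇔-∘ ∀ⁿ-sat S m (∀' ψ)
  where
  head∷tail : (ρ : Fin (suc m) → Carrier S) → ∀ i → _≈_ S ((ρ zero ∷ᵉ (ρ ∘ suc)) i) (ρ i)
  head∷tail ρ zero = ≈-refl S
  head∷tail ρ (suc i) = ≈-refl S

  uncurry-env : (∀ ρ a → S ⊨ ψ [ a ∷ᵉ ρ ]) ⇔ (∀ ρ → S ⊨ ψ [ ρ ])
  uncurry-env = mk⇔ (λ H ρ → sat-cong S ψ (head∷tail ρ) (H (ρ ∘ suc) (ρ zero)))
                    (λ H ρ a → H (a ∷ᵉ ρ))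

reduct : {σ : Signature} {n : ℕ} → Structure (extendSig σ n) → Structure σ
reduct S = record
  { Carrier = Carrier S ; _≈_ = _≈_ S ; isEquiv = isEquiv S
  ; op = op S ∘ inj₁ ; rel = rel S
  ; op-cong = op-cong S ∘ inj₁ ; rel-cong = rel-cong S }

reduct-≅ : {σ : Signature} {n : ℕ} {S T : Structure (extendSig σ n)} → S ≅ T → reduct S ≅ reduct T
reduct-≅ iso = record
  { to = to ; from = from ; to-cong = to-cong ; from-cong = from-cong
  ; to-from = to-from ; from-to = from-to
  ; to-op = to-op ∘ inj₁ ; to-rel = to-rel ; to-rel⁻¹ = to-rel⁻¹ }
  where open _≅_ iso

module Reduct {σ : Signature} {n : ℕ} (S : Structure (extendSig σ n)) where

  lift-term : ∀ {m} (t : Term σ m) ρ → _≈_ S (⟦ liftT {n = n} t ⟧ₜ S ρ) (⟦ t ⟧ₜ (reduct S) ρ)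
  lift-term (var i) ρ = ≈-refl S
  lift-term (app o ts) ρ = op-cong S (inj₁ o) (λ j → lift-term (ts j) ρ)

  lift-sat : ∀ {m} (φ : Formula σ m) ρ → S ⊨ liftF {n = n} φ [ ρ ] ⇔ reduct S ⊨ φ [ ρ ]
  lift-sat (t ≐ u) ρ = ≈-resp-⇔ S (lift-term t ρ) (lift-term u ρ)
  lift-sat (rel' r ts) ρ = rel-resp-⇔ S r (λ j → lift-term (ts j) ρ)
  lift-sat ⊥' ρ = ⇔-id _
  lift-sat (¬' φ) ρ = ¬-cong-⇔ (lift-sat φ ρ)
  lift-sat (φ ∧' ψ) ρ = lift-sat φ ρ ×-⇔ lift-sat ψ ρ
  lift-sat (φ ∨' ψ) ρ = lift-sat φ ρ ⊎-⇔ lift-sat ψ ρ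
  lift-sat (φ ⇒' ψ) ρ = →-cong-⇔ (lift-sat φ ρ) (lift-sat ψ ρ)
  lift-sat (∀' φ) ρ = Π-cong-⇔ λ a → lift-sat φ (a ∷ᵉ ρ)
  lift-sat (∃' φ) ρ = Σ-cong-⇔ λ a → lift-sat φ (a ∷ᵉ ρ)

open Reduct using (lift-sat)

lift-models : {σ : Signature} {n : ℕ} (T : Theory σ) (S : Structure (extendSig σ n)) →
              Models T (reduct S) → ∀ χ → T χ → S ⊨ liftF {n = n} χ [ noEnv ]
lift-models T S models-T χ Tχ = backward (lift-sat S χ noEnv) (models-T χ Tχ)

reduct-models : {σ : Signature} {n : ℕ} (T : Theory σ) (φ : Formula σ (suc n))
                (S : Structure (extendSig σ n)) →
                Models (extendTheory n T φ) S → Models T (reduct S)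
reduct-models T φ S models χ Tχ =
  forward (lift-sat S χ noEnv) (models (liftF χ) (inj₁ (χ , Tχ , refl)))

⊛ᴹ : {σ : Signature} {n : ℕ} (S : Structure (extendSig σ n)) → (Fin n → Carrier S) → Carrier S
⊛ᴹ S = op S (inj₂ tt)

⊛-axiom-sat : {σ : Signature} {n : ℕ} (φ : Formula σ (suc n)) (S : Structure (extendSig σ n)) →
              S ⊨ ⊛-axiom n φ [ noEnv ] ⇔ (∀ ρ → reduct S ⊨ φ [ ⊛ᴹ S ρ ∷ᵉ ρ ])
⊛-axiom-sat {n = n} φ S =
  Π-cong-⇔ (λ ρ → lift-sat S φ _ ⇔-∘ subst-sat S (⊛-evaluates ρ) (liftF φ))
  ⇔-∘ ∀ⁿ-sat S n (substF (⊛-subst n) (liftF φ))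
  where
  ⊛-evaluates : ∀ ρ → Substitution.Evaluates S (⊛-subst n) ρ (⊛ᴹ S ρ ∷ᵉ ρ)
  ⊛-evaluates ρ zero = ≈-refl S
  ⊛-evaluates ρ (suc i) = ≈-refl S

definable-≅ : {σ : Signature} {I : PFInterp σ} {n : ℕ} (⊛ : PFOp I n) (φ : Formula σ (suc n)) →
              AbstractlyDefinable I n ⊛ φ →
              ∀ {R : Structure σ} k → Dom I k → Cod I k → ∀ {A} (cl : Closed I k A) →
              (iso : R ≅ algebra I k A cl) → ∀ h ρ →
              let open _≅_ iso in
              R ⊨ φ [ h ∷ᵉ ρ ] ⇔ proj₁ (to h) ≈ₚ run ⊛ k (λ j → proj₁ (to (ρ j)))
definable-≅ {I = I} ⊛ φ definable k x y {A} cl iso h ρ =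
  ⇔-sym (mk⇔ (proj₁ defined) (proj₂ defined)) ⇔-∘ sat-↦ iso φ images
  where
  open _≅_ iso
  defined : (proj₁ (to h) ≈ₚ run ⊛ k (λ j → proj₁ (to (ρ j))) → algebra I k A cl ⊨ φ [ to h ∷ᵉ (to ∘ ρ) ])
          × (algebra I k A cl ⊨ φ [ to h ∷ᵉ (to ∘ ρ) ] → proj₁ (to h) ≈ₚ run ⊛ k (λ j → proj₁ (to (ρ j))))
  defined = definable k x y A cl (to h) (to ∘ ρ)

  images : ∀ i → _≈_ (algebra I k A cl) (to ((h ∷ᵉ ρ) i)) ((to h ∷ᵉ (to ∘ ρ)) i)
  images zero = λ _ → refl
  images (suc i) = λ _ → refl

saturate : {X Y : Set} → (PF X Y → Set) → PF X Y → Set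
saturate {X} {Y} A f = Σ (PF X Y) λ g → A g × g ≈ₚ f

expand-rep : {σ : Signature} {I : PFInterp σ} {n : ℕ} (⊛ : PFOp I n) (S : Structure (extendSig σ n)) →
             ∀ k → Dom I k → Cod I k → ∀ {A} (cl : Closed I k A) →
             (iso : reduct S ≅ algebra I k A cl) →
             (let open _≅_ iso in
              ∀ ρ → proj₁ (to (⊛ᴹ S ρ)) ≈ₚ run ⊛ k (λ j → proj₁ (to (ρ j)))) →
             Rep (extendI I n ⊛) S
expand-rep {I = I} {n} ⊛ S k x y {A} cl iso to-⊛ = k , x , y , saturate A , closed , iso′
  where
  open _≅_ iso

  closed : Closed (extendI I n ⊛) k (saturate A)
  closed (inj₁ o) fs gs =
    ⟦op⟧ I o k (proj₁ ∘ gs) , cl o _ (proj₁ ∘ proj₂ ∘ gs) , ⟦op⟧-cong I o k (proj₂ ∘ proj₂ ∘ gs)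
  closed (inj₂ tt) fs gs = proj₁ (to (⊛ᴹ S ρ)) , proj₂ (to (⊛ᴹ S ρ)) , to-⊛ρ≈⊛fs
    where
    g : Fin n → Σ _ A
    g j = proj₁ (gs j) , proj₁ (proj₂ (gs j))
    ρ : Fin n → Carrier S
    ρ = from ∘ g

    to-ρ≈fs : ∀ j → proj₁ (to (ρ j)) ≈ₚ fs j
    to-ρ≈fs j z = trans (to-from (g j) z) (proj₂ (proj₂ (gs j)) z)

    to-⊛ρ≈⊛fs : proj₁ (to (⊛ᴹ S ρ)) ≈ₚ run ⊛ k fs
    to-⊛ρ≈⊛fs z = trans (to-⊛ ρ z) (cong ⊛ k to-ρ≈fs z)

  iso′ : S ≅ algebra (extendI I n ⊛) k (saturate A) closed
  iso′ = record
    { to = λ s → proj₁ (to s) , proj₁ (to s) , proj₂ (to s) , (λ _ → refl)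
    ; from = λ (f , g , g∈A , g≈f) → from (g , g∈A)
    ; to-cong = to-cong
    ; from-cong = λ { {_ , _ , _ , g≈f} {_ , _ , _ , g′≈f′} f≈f′ →
        from-cong (λ z → trans (g≈f z) (trans (f≈f′ z) (sym (g′≈f′ z)))) }
    ; to-from = λ (f , g , g∈A , g≈f) z → trans (to-from (g , g∈A) z) (g≈f z)
    ; from-to = from-to
    ; to-op = λ { (inj₁ o) → to-op o ; (inj₂ tt) → to-⊛ }
    ; to-rel = to-rel
    ; to-rel⁻¹ = to-rel⁻¹ }

theorem3p7 : (σ : Signature) (I : PFInterp σ) (n : ℕ) (⊛ : PFOp I n)
    (φ : Formula σ (suc n)) (T : Theory σ) →
    AbstractlyDefinable I n ⊛ φ →
    SoundComplete I T →
    SoundComplete (extendI I n ⊛) (extendTheory n T φ)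
theorem3p7 σ I n ⊛ φ T definable T-axiomatises S = complete , sound
  where
  -- A model of T ∪ {⊛-axiom} has a representable reduct, and the ⊛-axiom
  -- makes that representation respect ⊛.
  complete : Models (extendTheory n T φ) S → Rep (extendI I n ⊛) S
  complete models
    with proj₁ (T-axiomatises (reduct S)) (reduct-models T φ S models)
  ... | k , x , y , A , cl , iso =
    expand-rep ⊛ S k x y cl iso λ ρ →
      forward (definable-≅ ⊛ φ definable k x y cl iso (⊛ᴹ S ρ) ρ)
        (forward (⊛-axiom-sat φ S) (models (⊛-axiom n φ) (inj₂ refl)) ρ)

  -- A representation of S restricts to one of its reduct, so S satisfies
  -- the lifted T; it respects ⊛, so S satisfies the ⊛-axiom.
  sound : Rep (extendI I n ⊛) S → Models (extendTheory n T φ) S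
  sound (k , x , y , A , cl , iso) = models
    where
    reduct-iso : reduct S ≅ algebra I k A (cl ∘ inj₁)
    reduct-iso = reduct-≅ iso
    models : Models (extendTheory n T φ) S
    models _ (inj₁ (χ , Tχ , refl)) =
      lift-models T S (proj₂ (T-axiomatises (reduct S)) (k , x , y , A , cl ∘ inj₁ , reduct-iso)) χ Tχ
    models _ (inj₂ refl) = backward (⊛-axiom-sat φ S) λ ρ →
      backward (definable-≅ ⊛ φ definable k x y (cl ∘ inj₁) reduct-iso (⊛ᴹ S ρ) ρ)
               (_≅_.to-op iso (inj₂ tt) ρ)
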